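{- For every $k\in\mathbb{N}$, every cycle has a consistent $(k+1\!:\!k)$-colouring with clustering $k^2+3k-1$.
   Context: A $(p\!:\!q)$-colouring $\alpha$ assigns to each vertex a $q$-subset of a palette of $p$ colours. It is consistent if for each vertex $x$ there is an ordering $\alpha_x^1,\dots,\alpha_x^q$ of $\alpha(x)$ such that $\alpha_x^i\ne\alpha_y^j$ for every edge $xy$ and all distinct $i,j\in[1,q]$. A monochromatic component for colour $\beta$ is a connected component of the subgraph induced by the vertices whose set contains $\beta$; clustering $c$ means every monochromatic component has at most $c$ vertices. -}

module Defs where

open import Data.Nat using (ℕ; zero; suc; _+_; _≤_)
open import Data.Nat.DivMod using (_%_)
open import Data.Fin using (Fin; toℕ)
open import Data.Fin.Subset using (Subset; _∈_; ∣_∣)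
open import Data.List using (List; length)
open import Data.List.Relation.Unary.All using (All)
open import Data.List.Relation.Unary.Unique.Propositional using (Unique)
open import Data.Product using (Σ; _×_; ∃-syntax)
open import Data.Sum using (_⊎_)
open import Relation.Binary.PropositionalEquality using (_≡_; _≢_)
open import Function.Definitions using (Injective)

record Graph : Set₁ where
  field
    V   : ℕ
    Adj : Fin V → Fin V → Set
open Graph public

-- The cycle C_n for n = m + 3 on vertices 0..n-1, with x ~ y iff y ≡ x+1 (mod n) or x ≡ y+1 (mod n).
Cycle : ℕ → Graph
Cycle m = record
  { V   = suc (suc (suc m))
  ; Adj = λ x y → (toℕ y ≡ (toℕ x + 1) % suc (suc (suc m)))
                ⊎ (toℕ x ≡ (toℕ y + 1) % suc (suc (suc m)))
  }

IsColouring : (G : Graph) (p q : ℕ) → (Fin (V G) → Subset p) → Set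
IsColouring G p q α = ∀ x → ∣ α x ∣ ≡ q

IsOrdering : {p q : ℕ} → Subset p → (Fin q → Fin p) → Set
IsOrdering {p} {q} s o = Injective _≡_ _≡_ o × (∀ (c : Fin p) → (c ∈ s → ∃[ i ] o i ≡ c) × (∀ i → o i ≡ c → c ∈ s))

Consistent : (G : Graph) (p q : ℕ) → (Fin (V G) → Subset p) → Set
Consistent G p q α =
  Σ (Fin (V G) → Fin q → Fin p) λ o →
    (∀ x → IsOrdering (α x) (o x)) ×
    (∀ x y → Adj G x y → ∀ (i j : Fin q) → i ≢ j → o x i ≢ o y j)

data MonoReach (G : Graph) {p : ℕ} (α : Fin (V G) → Subset p) (β : Fin p) (v : Fin (V G)) : Fin (V G) → Set where
  here : β ∈ α v → MonoReach G α β v v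
  step : ∀ {u w} → MonoReach G α β v u → Adj G u w → β ∈ α w → MonoReach G α β v w

HasClustering : (G : Graph) {p : ℕ} → (Fin (V G) → Subset p) → ℕ → Set
HasClustering G α c =
  ∀ β v (ws : List (Fin (V G))) → Unique ws → All (MonoReach G α β v) ws → length ws ≤ c

module Submission where

-- Give vertex t every colour but one: colour 0 is missing when t is even, colour 1 + (⌊t/2⌋ mod k)
-- when t is odd. Every edge has an endpoint missing 0 (the wrap-around edge ends at vertex 0). Such a
-- vertex lists its colours as 1, …, k and any other vertex as 1, …, k with 0 in place of its missing
-- colour, so two neighbours never clash at different positions. Colour 0 is then an independent set,
-- and colour c + 1 is missing exactly at the vertices ≡ 2c + 1 (mod 2k); these cut the cycle into
-- arcs of fewer than 2k vertices, except for the arc through the wrap-around edge, which has fewer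
-- than 4k ≤ k² + 3k vertices.

open import Defs
open import Data.Nat using (ℕ; suc; _+_; _*_; _∸_)
open import Data.Fin.Subset using (Subset)
open import Data.Fin using (Fin)
open import Data.Product using (Σ; _×_)

open import Data.Nat as ℕ using (_≤_; _<_; NonZero; z≤n; s≤s; z<s)
open import Data.Nat.Properties
open import Data.Nat.DivMod
open import Data.Nat.Divisibility using (n∣m*n)
open import Data.Nat.Solver using (module +-*-Solver)
open import Data.Fin as Fin using (zero; suc; toℕ; fromℕ<)
open import Data.Fin.Properties as Fin using (toℕ-injective; fromℕ<-injective; pigeonhole)
open import Data.Fin.Subset using (_∈_; _∉_; ∁; ⁅_⁆)
open import Data.Fin.Subset.Properties using (∣∁p∣≡n∸∣p∣; ∣⁅x⁆∣≡1; x∈⁅y⁆⇒x≡y; x∈⁅x⁆; x∈∁p⇒x∉p; x∉p⇒x∈∁p)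
open import Data.List using (List; length; lookup)
open import Data.List.Relation.Unary.All as All using (All)
open import Data.List.Relation.Unary.Unique.Propositional using (Unique)
open import Data.List.Relation.Unary.AllPairs using (_∷_)
open import Data.List.Membership.Propositional.Properties using (∈-lookup)
open import Data.Product using (_,_; proj₁; ∃-syntax)
open import Data.Sum as Sum using (_⊎_; inj₁; inj₂)
open import Function using (_∘_)
open import Function.Definitions using (Injective)
open import Relation.Nullary using (¬_; yes; no; contradiction)
open import Relation.Binary.PropositionalEquality

private
  variable
    A : Set

lookup-injective : ∀ {xs : List A} → Unique xs → ∀ i j → lookup xs i ≡ lookup xs j → i ≡ j
lookup-injective (_ ∷ _)   zero    zero    _  = refl
lookup-injective (x∉ ∷ _)  zero    (suc j) eq = contradiction eq (All.lookup x∉ (∈-lookup j))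
lookup-injective (x∉ ∷ _)  (suc i) zero    eq = contradiction (sym eq) (All.lookup x∉ (∈-lookup i))
lookup-injective (_ ∷ xs!) (suc i) (suc j) eq = cong suc (lookup-injective xs! i j eq)

length≤-of-injection : ∀ {P : A → Set} {B} (f : ∀ {x} → P x → Fin B) →
                       (∀ {x y} (px : P x) (py : P y) → f px ≡ f py → x ≡ y) →
                       ∀ {xs} → Unique xs → All P xs → length xs ≤ B
length≤-of-injection {P = P} f f-inj {xs} xs! pxs = ≮⇒≥ no-collision
  where
  P[_] : ∀ i → P (lookup xs i)
  P[ i ] = All.lookup pxs (∈-lookup i)
  no-collision : ¬ (_ < length xs)
  no-collision B<len =
    let i , j , i<j , fi≡fj = pigeonhole B<len (λ i → f P[ i ])
    in Fin.<⇒≢ i<j (lookup-injective xs! i j (f-inj P[ i ] P[ j ] fi≡fj))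

record ComponentLabelling (G : Graph) {p} (α : Fin (V G) → Subset p) (β : Fin p) (B : ℕ) : Set where
  field
    block              : Fin (V G) → ℕ
    position           : Fin (V G) → ℕ
    block-adj          : ∀ {u w} → Adj G u w → β ∈ α u → β ∈ α w → block u ≡ block w
    position-injective : ∀ {u w} → β ∈ α u → β ∈ α w → block u ≡ block w → position u ≡ position w → u ≡ w
    position<          : ∀ {u} → β ∈ α u → position u < B

module _ {G : Graph} {p} {α : Fin (V G) → Subset p} {β : Fin p} {B} (L : ComponentLabelling G α β B) where
  open ComponentLabelling L

  reach⇒sameBlock : ∀ {v w} → MonoReach G α β v w → β ∈ α w × block w ≡ block v
  reach⇒sameBlock (here β∈v) = β∈v , refl
  reach⇒sameBlock (step r u~w β∈w) =
    let β∈u , u≡v = reach⇒sameBlock r in β∈w , trans (sym (block-adj u~w β∈u β∈w)) u≡v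

  component-length≤ : ∀ v (ws : List (Fin (V G))) → Unique ws → All (MonoReach G α β v) ws → length ws ≤ B
  component-length≤ v ws = length≤-of-injection index index-injective
    where
    index : ∀ {w} → MonoReach G α β v w → Fin B
    index r = fromℕ< (position< (proj₁ (reach⇒sameBlock r)))
    index-injective : ∀ {u w} (ru : MonoReach G α β v u) (rw : MonoReach G α β v w) → index ru ≡ index rw → u ≡ w
    index-injective ru rw eq =
      let β∈u , u≡v = reach⇒sameBlock ru
          β∈w , w≡v = reach⇒sameBlock rw
      in position-injective β∈u β∈w (trans u≡v (sym w≡v)) (fromℕ<-injective _ _ _ _ eq)

  weaken-bound : ∀ {B′} → B ≤ B′ → ComponentLabelling G α β B′
  weaken-bound B≤B′ = record
    { block = block ; position = position ; block-adj = block-adj ; position-injective = position-injective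
    ; position< = λ β∈u → <-≤-trans (position< β∈u) B≤B′ }

absentColourLabelling : ∀ {G : Graph} {p} {α : Fin (V G) → Subset p} {β} → (∀ x → β ∉ α x) → ComponentLabelling G α β 0
absentColourLabelling β∉ = record
  { block = λ _ → 0 ; position = λ _ → 0
  ; block-adj = λ _ β∈u _ → contradiction β∈u (β∉ _)
  ; position-injective = λ β∈u _ _ _ → contradiction β∈u (β∉ _)
  ; position< = λ β∈u → contradiction β∈u (β∉ _) }

independentColourLabelling : ∀ {G : Graph} {p} {α : Fin (V G) → Subset p} {β} →
                             (∀ {u w} → Adj G u w → β ∈ α u → β ∉ α w) → ComponentLabelling G α β 1
independentColourLabelling independent = record
  { block = toℕ ; position = λ _ → 0
  ; block-adj = λ u~w β∈u β∈w → contradiction β∈w (independent u~w β∈u)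
  ; position-injective = λ _ _ u≡w _ → toℕ-injective u≡w
  ; position< = λ _ → s≤s z≤n }

data CycleStep (m : ℕ) : ℕ → ℕ → Set where
  next : ∀ {a} → CycleStep m a (suc a)
  wrap : CycleStep m (suc (suc m)) 0

successor⇒cycleStep : ∀ {m} (x y : Fin (V (Cycle m))) → toℕ y ≡ (toℕ x + 1) % V (Cycle m) →
                      CycleStep m (toℕ x) (toℕ y)
successor⇒cycleStep {m} x y y≡x+1 with suc (toℕ x) ℕ.<? V (Cycle m)
... | yes x+1<n = subst (CycleStep m (toℕ x)) (sym y≡suc) next
  where
  y≡suc : toℕ y ≡ suc (toℕ x)
  y≡suc = trans y≡x+1 (trans (cong (_% V (Cycle m)) (+-comm (toℕ x) 1)) (m<n⇒m%n≡m x+1<n))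
... | no x+1≮n = subst₂ (CycleStep m) (sym x≡last) (sym y≡0) wrap
  where
  x+1≡n : suc (toℕ x) ≡ V (Cycle m)
  x+1≡n = ≤-antisym (Fin.toℕ<n x) (≮⇒≥ x+1≮n)
  x≡last : toℕ x ≡ suc (suc m)
  x≡last = suc-injective x+1≡n
  y≡0 : toℕ y ≡ 0
  y≡0 = trans y≡x+1 (trans (cong (_% V (Cycle m)) (trans (+-comm (toℕ x) 1) x+1≡n)) (n%n≡0 (V (Cycle m))))

adj⇒cycleStep : ∀ {m} {x y : Fin (V (Cycle m))} → Adj (Cycle m) x y →
                CycleStep m (toℕ x) (toℕ y) ⊎ CycleStep m (toℕ y) (toℕ x)
adj⇒cycleStep {x = x} {y} (inj₁ y≡x+1) = inj₁ (successor⇒cycleStep x y y≡x+1)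
adj⇒cycleStep {x = x} {y} (inj₂ x≡y+1) = inj₂ (successor⇒cycleStep y x x≡y+1)

suc-/ : ∀ a P .{{_ : NonZero P}} → suc (a % P) < P → suc a / P ≡ a / P
suc-/ a P a%P+1<P = begin
  suc a / P                            ≡⟨ cong (λ z → suc z / P) (m≡m%n+[m/n]*n a P) ⟩
  (suc (a % P) + a / P * P) / P        ≡⟨ +-distrib-/-∣ʳ (suc (a % P)) (n∣m*n (a / P)) ⟩
  suc (a % P) / P + a / P * P / P      ≡⟨ cong₂ _+_ (m<n⇒m/n≡0 a%P+1<P) (m*n/n≡m (a / P) P) ⟩
  a / P                                ∎
  where open ≡-Reasoning

module ResidueAvoidingLabelling {m p} (α : Fin (V (Cycle m)) → Subset p) (β : Fin p) (P r : ℕ) {{_ : NonZero P}}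
  (r<P : r < P) (avoids : ∀ x → β ∈ α x → toℕ x % P ≢ r) where

  -- Shifting by d moves the vertices ≡ r (mod P) to the last offset P − 1 of the blocks [jP, (j+1)P),
  -- so along the path 0, 1, …, n − 1 a β-component never leaves its block.
  d : ℕ
  d = P ∸ suc r

  d+[1+r]≡P : d + suc r ≡ P
  d+[1+r]≡P = m∸n+n≡m r<P

  block offset : ℕ → ℕ
  block  t = (t + d) / P
  offset t = (t + d) % P

  offset-end⇒residue : ∀ t → suc (offset t) ≡ P → t % P ≡ r
  offset-end⇒residue t end = begin
    t % P                   ≡⟨ cong (_% P) t≡r+qP ⟩
    (r + block t * P) % P   ≡⟨ [m+kn]%n≡m%n r (block t) P ⟩
    r % P                   ≡⟨ m<n⇒m%n≡m r<P ⟩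
    r                       ∎
    where
    open ≡-Reasoning
    t≡r+qP : t ≡ r + block t * P
    t≡r+qP = suc-injective (+-cancelˡ-≡ d _ _ (begin
      d + suc t                    ≡⟨ +-suc d t ⟩
      suc (d + t)                  ≡⟨ cong suc (+-comm d t) ⟩
      suc (t + d)                  ≡⟨ cong suc (m≡m%n+[m/n]*n (t + d) P) ⟩
      suc (offset t) + block t * P ≡⟨ cong (_+ block t * P) (trans end (sym d+[1+r]≡P)) ⟩
      d + suc r + block t * P      ≡⟨ +-assoc d (suc r) _ ⟩
      d + suc (r + block t * P)    ∎))

  present⇒offset-not-end : ∀ x → β ∈ α x → suc (offset (toℕ x)) < P
  present⇒offset-not-end x β∈x =
    ≤∧≢⇒< (m%n<n (toℕ x + d) P) (avoids x β∈x ∘ offset-end⇒residue (toℕ x))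

  block-suc : ∀ a → suc (offset a) < P → block (suc a) ≡ block a
  block-suc a = suc-/ (a + d) P

  block-0 : block 0 ≡ 0
  block-0 = m<n⇒m/n≡0 (subst (d <_) d+[1+r]≡P (m<m+n d z<s))

  offset-injective : ∀ a b → block a ≡ block b → offset a ≡ offset b → a ≡ b
  offset-injective a b qa≡qb oa≡ob = +-cancelʳ-≡ d a b (begin
    a + d                        ≡⟨ m≡m%n+[m/n]*n (a + d) P ⟩
    offset a + block a * P       ≡⟨ cong₂ (λ o q → o + q * P) oa≡ob qa≡qb ⟩
    offset b + block b * P       ≡⟨ m≡m%n+[m/n]*n (b + d) P ⟨
    b + d                        ∎)
    where open ≡-Reasoning

  lastBlock : ℕ
  lastBlock = block (suc (suc m))

  -- The last block continues into block 0 across the edge from the last vertex to vertex 0,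
  -- so the two are merged, the last one being placed after block 0.
  merge : ℕ → ℕ
  merge q with q ℕ.≟ lastBlock
  ... | yes _ = 0
  ... | no _  = q

  place : ℕ → ℕ → ℕ
  place q o with q ℕ.≟ lastBlock
  ... | yes _ = P + o
  ... | no _  = o

  merge-last : merge lastBlock ≡ 0
  merge-last with lastBlock ℕ.≟ lastBlock
  ... | yes _ = refl
  ... | no ≢  = contradiction refl ≢

  merge-0 : merge 0 ≡ 0
  merge-0 with 0 ℕ.≟ lastBlock
  ... | yes _ = refl
  ... | no _  = refl

  label : ℕ → ℕ
  label t = merge (block t)

  label-step : ∀ {a b} → CycleStep m a b → suc (offset a) < P → label a ≡ label b
  label-step {a} next not-end = cong merge (sym (block-suc a not-end))
  label-step wrap     _       = trans merge-last (sym (trans (cong merge block-0) merge-0))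

  place-injective : ∀ {q q′ o o′} → o < P → o′ < P → merge q ≡ merge q′ → place q o ≡ place q′ o′ → q ≡ q′ × o ≡ o′
  place-injective {q} {q′} o<P o′<P mq≡mq′ pq≡pq′ with q ℕ.≟ lastBlock | q′ ℕ.≟ lastBlock
  ... | yes q≡ | yes q′≡ = trans q≡ (sym q′≡) , +-cancelˡ-≡ P _ _ pq≡pq′
  ... | no _   | no _    = mq≡mq′ , pq≡pq′
  ... | yes _  | no _    = contradiction (subst (P ≤_) pq≡pq′ (m≤m+n P _)) (<⇒≱ o′<P)
  ... | no _   | yes _   = contradiction (subst (P ≤_) (sym pq≡pq′) (m≤m+n P _)) (<⇒≱ o<P)

  place-bound : ∀ q {o} → suc o < P → suc (place q o) < P + P
  place-bound q {o} o+1<P with q ℕ.≟ lastBlock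
  ... | yes _ = subst (_≤ P + P) (trans (+-suc P (suc o)) (cong suc (+-suc P o))) (+-monoʳ-≤ P o+1<P)
  ... | no _  = ≤-trans o+1<P (m≤m+n P P)

  labelling : ComponentLabelling (Cycle m) α β (P + P ∸ 1)
  labelling = record
    { block              = label ∘ toℕ
    ; position           = λ x → place (block (toℕ x)) (offset (toℕ x))
    ; block-adj          = block-adj
    ; position-injective = position-injective
    ; position<          = λ {x} β∈x → m+n≤o⇒m≤o∸n (suc _) (subst (_≤ P + P) (+-comm 1 _)
                                          (place-bound (block (toℕ x)) (present⇒offset-not-end x β∈x)))
    }
    where
    block-adj : ∀ {x y} → Adj (Cycle m) x y → β ∈ α x → β ∈ α y → label (toℕ x) ≡ label (toℕ y)
    block-adj x~y β∈x β∈y with adj⇒cycleStep x~y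
    ... | inj₁ x→y = label-step x→y (present⇒offset-not-end _ β∈x)
    ... | inj₂ y→x = sym (label-step y→x (present⇒offset-not-end _ β∈y))
    position-injective : ∀ {x y} → β ∈ α x → β ∈ α y → label (toℕ x) ≡ label (toℕ y) →
                         place (block (toℕ x)) (offset (toℕ x)) ≡ place (block (toℕ y)) (offset (toℕ y)) → x ≡ y
    position-injective {x} {y} _ _ lx≡ly px≡py =
      let qx≡qy , ox≡oy = place-injective (m%n<n (toℕ x + d) P) (m%n<n (toℕ y + d) P) lx≡ly px≡py
      in toℕ-injective (offset-injective (toℕ x) (toℕ y) qx≡qy ox≡oy)

enum∁ : ∀ {K} → Fin (suc K) → Fin K → Fin (suc K)
enum∁ zero    i = suc i
enum∁ (suc b) i with i Fin.≟ b
... | yes _ = zero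
... | no _  = suc i

enum∁-suc : ∀ {K} (b : Fin (suc K)) {i j} → enum∁ b j ≡ suc i → j ≡ i
enum∁-suc zero refl = refl
enum∁-suc (suc b) {i} {j} eq with j Fin.≟ b
... | no _ = Fin.suc-injective eq

enum∁-≢ : ∀ {K} (b : Fin (suc K)) i → enum∁ b i ≢ b
enum∁-≢ zero    i ()
enum∁-≢ (suc b) i eq with i Fin.≟ b
... | no i≢b = i≢b (Fin.suc-injective eq)

enum∁-injective : ∀ {K} (b : Fin (suc K)) → Injective _≡_ _≡_ (enum∁ b)
enum∁-injective zero    eq = Fin.suc-injective eq
enum∁-injective (suc b) {i} {j} eq with i Fin.≟ b | j Fin.≟ b
... | yes i≡b | yes j≡b = trans i≡b (sym j≡b)
... | no _    | no _    = Fin.suc-injective eq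

enum∁-surjective : ∀ {K} (b c : Fin (suc K)) → c ≢ b → ∃[ i ] enum∁ b i ≡ c
enum∁-surjective zero    zero    c≢b = contradiction refl c≢b
enum∁-surjective zero    (suc c) _   = c , refl
enum∁-surjective (suc b) zero    _   = b , hit
  where
  hit : enum∁ (suc b) b ≡ zero
  hit with b Fin.≟ b
  ... | yes _ = refl
  ... | no b≢b = contradiction refl b≢b
enum∁-surjective (suc b) (suc c) c≢b = c , miss
  where
  miss : enum∁ (suc b) c ≡ suc c
  miss with c Fin.≟ b
  ... | yes c≡b = contradiction (cong suc c≡b) c≢b
  ... | no _    = refl

∈∁⁅⁆⇒≢ : ∀ {n} {b c : Fin n} → c ∈ ∁ ⁅ b ⁆ → c ≢ b
∈∁⁅⁆⇒≢ {c = c} c∈ c≡b = x∈∁p⇒x∉p c∈ (subst (λ b → c ∈ ⁅ b ⁆) c≡b (x∈⁅x⁆ c))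

≢⇒∈∁⁅⁆ : ∀ {n} {b c : Fin n} → c ≢ b → c ∈ ∁ ⁅ b ⁆
≢⇒∈∁⁅⁆ c≢b = x∉p⇒x∈∁p (c≢b ∘ x∈⁅y⁆⇒x≡y _)

enum∁-isOrdering : ∀ {K} (b : Fin (suc K)) → IsOrdering (∁ ⁅ b ⁆) (enum∁ b)
enum∁-isOrdering b = enum∁-injective b , λ c →
    (λ c∈ → enum∁-surjective b c (∈∁⁅⁆⇒≢ c∈))
  , (λ i i↦c → ≢⇒∈∁⁅⁆ (subst (_≢ b) i↦c (enum∁-≢ b i)))

enum∁-apart : ∀ {K} {b b′ : Fin (suc K)} → b ≡ zero ⊎ b′ ≡ zero → ∀ {i j} → i ≢ j → enum∁ b i ≢ enum∁ b′ j
enum∁-apart {b′ = b′} (inj₁ refl) i≢j eq = i≢j (sym (enum∁-suc b′ (sym eq)))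
enum∁-apart {b = b}   (inj₂ refl) i≢j eq = i≢j (enum∁-suc b eq)

module _ (G : Graph) {K} (missing : Fin (V G) → Fin (suc K)) where

  ∁⁅⁆-isColouring : IsColouring G (suc K) K (λ x → ∁ ⁅ missing x ⁆)
  ∁⁅⁆-isColouring x = trans (∣∁p∣≡n∸∣p∣ ⁅ missing x ⁆) (cong (suc K ∸_) (∣⁅x⁆∣≡1 (missing x)))

  ∁⁅⁆-consistent : (∀ {x y} → Adj G x y → missing x ≡ zero ⊎ missing y ≡ zero) →
                   Consistent G (suc K) K (λ x → ∁ ⁅ missing x ⁆)
  ∁⁅⁆-consistent 0-on-every-edge =
    enum∁ ∘ missing , enum∁-isOrdering ∘ missing , λ _ _ x~y _ _ → enum∁-apart (0-on-every-edge x~y)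

module CycleColouring (K : ℕ) {{_ : NonZero K}} (m : ℕ) where

  missingFor : ℕ → ℕ → Fin (suc K)
  missingFor 0       _ = zero
  missingFor (suc _) h = suc (h mod K)

  missingAt : ℕ → Fin (suc K)
  missingAt t = missingFor (t % 2) (t / 2)

  missing : Fin (V (Cycle m)) → Fin (suc K)
  missing = missingAt ∘ toℕ

  α : Fin (V (Cycle m)) → Subset (suc K)
  α x = ∁ ⁅ missing x ⁆

  even⊎suc-even : ∀ a → a % 2 ≡ 0 ⊎ suc a % 2 ≡ 0
  even⊎suc-even 0             = inj₁ refl
  even⊎suc-even 1             = inj₂ refl
  even⊎suc-even (suc (suc a)) = even⊎suc-even a

  step-meets-0 : ∀ {a b} → CycleStep m a b → missingAt a ≡ zero ⊎ missingAt b ≡ zero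
  step-meets-0 {a} next =
    Sum.map (cong (λ r → missingFor r (a / 2))) (cong (λ r → missingFor r (suc a / 2))) (even⊎suc-even a)
  step-meets-0 wrap     = inj₂ refl

  adj-meets-0 : ∀ {x y} → Adj (Cycle m) x y → missing x ≡ zero ⊎ missing y ≡ zero
  adj-meets-0 x~y with adj⇒cycleStep x~y
  ... | inj₁ x→y = step-meets-0 x→y
  ... | inj₂ y→x = Sum.swap (step-meets-0 y→x)

  P : ℕ
  P = K * 2

  instance
    P-nonZero : NonZero P
    P-nonZero = m*n≢0 K 2

  residue⇒missing : ∀ t (c : Fin K) → t % P ≡ 1 + toℕ c * 2 → missingAt t ≡ suc c
  residue⇒missing t c t≡ = begin
    missingFor (t % 2) (t / 2)   ≡⟨ cong (λ r → missingFor r (t / 2)) odd ⟩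
    suc ((t / 2) mod K)          ≡⟨ cong suc (toℕ-injective (trans (Fin.toℕ-fromℕ< _) half)) ⟩
    suc c                        ∎
    where
    open ≡-Reasoning
    odd : t % 2 ≡ 1
    odd = begin
      t % 2                  ≡⟨ m∣n⇒o%n%m≡o%m 2 P t (n∣m*n K) ⟨
      t % P % 2              ≡⟨ cong (_% 2) t≡ ⟩
      (1 + toℕ c * 2) % 2    ≡⟨ [m+kn]%n≡m%n 1 (toℕ c) 2 ⟩
      1                      ∎
    half : t / 2 % K ≡ toℕ c
    half = begin
      t / 2 % K              ≡⟨ m%[n*o]/o≡m/o%n t K 2 ⟨
      t % P / 2              ≡⟨ cong (_/ 2) t≡ ⟩
      (1 + toℕ c * 2) / 2    ≡⟨ +-distrib-/-∣ʳ 1 {d = 2} (n∣m*n (toℕ c)) ⟩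
      0 + toℕ c * 2 / 2      ≡⟨ m*n/n≡m (toℕ c) 2 ⟩
      toℕ c                  ∎

  colour0-labelling : ComponentLabelling (Cycle m) α zero 1
  colour0-labelling = independentColourLabelling λ {x} {y} x~y 0∈x 0∈y → Sum.[
    (λ x↦0 → ∈∁⁅⁆⇒≢ 0∈x (sym x↦0)) ,
    (λ y↦0 → ∈∁⁅⁆⇒≢ 0∈y (sym y↦0)) ] (adj-meets-0 x~y)

  colour-suc-labelling : ∀ c → ComponentLabelling (Cycle m) α (suc c) (P + P ∸ 1)
  colour-suc-labelling c = ResidueAvoidingLabelling.labelling α (suc c) P (1 + toℕ c * 2)
    (*-monoˡ-≤ 2 (Fin.toℕ<n c))
    (λ x c∈x x≡ → ∈∁⁅⁆⇒≢ c∈x (sym (residue⇒missing (toℕ x) c x≡)))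

4K∸1≤K²+3K∸1 : ∀ K .{{_ : NonZero K}} → K * 2 + K * 2 ∸ 1 ≤ K * K + 3 * K ∸ 1
4K∸1≤K²+3K∸1 K = ∸-monoˡ-≤ 1 (subst (_≤ K * K + 3 * K) 4K≡K+3K (+-monoˡ-≤ (3 * K) (m≤m*n K K)))
  where
  open +-*-Solver
  4K≡K+3K : K + 3 * K ≡ K * 2 + K * 2
  4K≡K+3K = solve 1 (λ K → K :+ con 3 :* K := K :* con 2 :+ K :* con 2) refl K

mainTheorem13 : (k m : ℕ) →
    Σ (Fin (V (Cycle m)) → Subset (suc k)) λ α →
      IsColouring (Cycle m) (suc k) k α ×
      Consistent (Cycle m) (suc k) k α ×
      HasClustering (Cycle m) α (k * k + 3 * k ∸ 1)
mainTheorem13 0 m =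
    (λ _ → ∁ ⁅ zero ⁆)
  , ∁⁅⁆-isColouring (Cycle m) (λ _ → zero)
  , ∁⁅⁆-consistent (Cycle m) (λ _ → zero) (λ _ → inj₁ refl)
  , λ { zero → component-length≤ (absentColourLabelling λ _ 0∈ → ∈∁⁅⁆⇒≢ 0∈ refl) }
mainTheorem13 (suc k) m =
    α
  , ∁⁅⁆-isColouring (Cycle m) missing
  , ∁⁅⁆-consistent (Cycle m) missing adj-meets-0
  , component-length≤ ∘ labelling
  where
  open CycleColouring (suc k) m
  labelling : ∀ β → ComponentLabelling (Cycle m) α β (suc k * suc k + 3 * suc k ∸ 1)
  labelling zero    = weaken-bound colour0-labelling (≤-trans (s≤s z≤n) (4K∸1≤K²+3K∸1 (suc k)))
  labelling (suc c) = weaken-bound (colour-suc-labelling c) (4K∸1≤K²+3K∸1 (suc k))
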